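{- Let $N$ be a positive integer and let $\boldsymbol{k}=(k_1,\dots,k_r)$ be an index of positive integers with $r\ge 1$ and weight $k=k_1+\cdots+k_r$. Then \[ \sum_{0<n_1<\cdots<n_r<N}\frac{1}{n_1^{k_1}\cdots n_r^{k_r}} =\sum_{\substack{(\boldsymbol{n}_1,\dots,\boldsymbol{n}_r)\in S_N(\boldsymbol{k}) \\ \mathrm{dep}(\boldsymbol{n}_i)=k_i \text{ for all } i\in[r]}}\ \prod_{i=1}^r P_{k_i}^{(N)}(\boldsymbol{n}_i), \] where $S_N(\boldsymbol{k})$ and $P_k^{(N)}$ are as defined in the context. That is, $\zeta_{<N}(\boldsymbol{k})=\zeta^{\flat}_{<N}(\boldsymbol{k})$.
   Context: An index is a finite tuple $\boldsymbol{k}=(k_1,\dots,k_r)$ of positive integers; its depth is $\mathrm{dep}(\boldsymbol{k})=r$ and weight $\mathrm{wt}(\boldsymbol{k})=k_1+\cdots+k_r$. For a positive integer $n$, $[n]=\{1,\dots,n\}$. For a positive integer $k$ and an integer tuple $\boldsymbol{n}=(n_1,\dots,n_k)$ with $0<n_1<N$ and $n_2,\dots,n_k>0$, set $P_k^{(N)}(\boldsymbol{n})=\frac{1}{(N-n_1)n_2\cdots n_k}$ (so $P_1^{(N)}(n_1)=1/(N-n_1)$). For $\boldsymbol{k}$ of weight $k$, let $J(\boldsymbol{k})=\{1,k_1+1,k_1+k_2+1,\dots,k_1+\cdots+k_{r-1}+1,k+1\}$ and \[ S_N(\boldsymbol{k})=\{(n_1,\dots,n_k)\in\mathbb{Z}^k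 : n_{i-1}<n_i \text{ if } i\in J(\boldsymbol{k}),\ n_{i-1}\le n_i \text{ if } i\in[k]\setminus J(\boldsymbol{k})\}, \] with the conventions $n_0=0$, $n_{k+1}=N$ (the condition for $i=k+1$ is $n_k<N$). A tuple $(n_1,\dots,n_k)$ is written as the concatenation $(\boldsymbol{n}_1,\dots,\boldsymbol{n}_r)$ with $\mathrm{dep}(\boldsymbol{n}_i)=k_i$, i.e. $\boldsymbol{n}_i$ consists of the next $k_i$ consecutive entries. Example: $\zeta^{\flat}_{<N}(2,3)=\sum_{0<n_1\le n_2<n_3\le n_4\le n_5<N}\frac{1}{(N-n_1)n_2(N-n_3)n_4n_5}$. -}

module Defs where

open import Data.Nat using (ℕ; zero; suc; _+_; _*_; _∸_; _^_; _<ᵇ_; _≤ᵇ_)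
open import Data.Bool using (Bool; true; false; _∧_; if_then_else_)
open import Data.List using (List; []; _∷_; map; concatMap; filter; _++_; length; upTo; take; drop)
open import Data.Nat.ListAction using (sum)
import Data.Rational as ℚ
open ℚ using (ℚ)
open import Data.Integer using (+_)
open import Relation.Binary.PropositionalEquality using (_≡_)
open import Relation.Nullary.Decidable using (Dec; yes; no)
open import Data.Bool using (T)
open import Data.Bool.Properties using (T?)

-- 1/d as a rational; only ever applied to d > 0 in the statement
-- (recip 0 = 0 is a junk value never used on the relevant index sets).
recip : ℕ → ℚ
recip zero    = ℚ.0ℚ
recip (suc d) = (+ 1) ℚ./ suc d

Σℚ : List ℚ → ℚ
Σℚ []       = ℚ.0ℚ
Σℚ (x ∷ xs) = x ℚ.+ Σℚ xs

Πℚ : List ℚ → ℚ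
Πℚ []       = ℚ.1ℚ
Πℚ (x ∷ xs) = x ℚ.* Πℚ xs

tuples : ℕ → ℕ → List (List ℕ)
tuples N zero    = [] ∷ []
tuples N (suc m) = concatMap (λ a → map (a ∷_) (tuples N m)) (upTo N)

weight : List ℕ → ℕ
weight = sum

strictChain : ℕ → ℕ → List ℕ → Bool
strictChain N prev []       = prev <ᵇ N
strictChain N prev (n ∷ ns) = (prev <ᵇ n) ∧ strictChain N n ns

zetaTerm : List ℕ → List ℕ → ℚ
zetaTerm (k ∷ ks) (n ∷ ns) = recip (n ^ k) ℚ.* zetaTerm ks ns
zetaTerm _        _        = ℚ.1ℚ

ζ<N : ℕ → List ℕ → ℚ
ζ<N N ks = Σℚ (map (zetaTerm ks)
                (filter (λ ns → T? (strictChain N 0 ns)) (tuples N (length ks))))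

Jset : List ℕ → List ℕ
Jset ks = go 1 ks
  where
  go : ℕ → List ℕ → List ℕ
  go p []       = p ∷ []
  go p (k ∷ ks) = p ∷ go (p + k) ks

member : ℕ → List ℕ → Bool
member x []       = false
member x (y ∷ ys) = ((x ≤ᵇ y) ∧ (y ≤ᵇ x)) ∨' member x ys
  where
  _∨'_ : Bool → Bool → Bool
  true  ∨' _ = true
  false ∨' b = b

-- check the conditions for i = 1,…,k+1 with n_0 = 0, n_{k+1} = N:
-- n_{i-1} < n_i if i ∈ J(k), n_{i-1} ≤ n_i otherwise.
-- Arguments: J, current position i, n_{i-1}, remaining entries n_i,….
chainS : List ℕ → ℕ → ℕ → ℕ → List ℕ → Bool
chainS J N i prev []       = if member i J then prev <ᵇ N else prev ≤ᵇ N
chainS J N i prev (n ∷ ns) =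
  (if member i J then prev <ᵇ n else prev ≤ᵇ n) ∧ chainS J N (suc i) n ns

inS : ℕ → List ℕ → List ℕ → Bool
inS N ks ns = chainS (Jset ks) N 1 0 ns

P : ℕ → List ℕ → ℚ
P N []       = ℚ.1ℚ
P N (n ∷ ns) = recip (N ∸ n) ℚ.* Πℚ (map recip ns)

blocks : List ℕ → List ℕ → List (List ℕ)
blocks []       ns = []
blocks (k ∷ ks) ns = take k ns ∷ blocks ks (drop k ns)

flatTerm : ℕ → List ℕ → List ℕ → ℚ
flatTerm N ks ns = Πℚ (map (P N) (blocks ks ns))

ζ♭<N : ℕ → List ℕ → ℚ
ζ♭<N N ks = Σℚ (map (flatTerm N ks)
                 (filter (λ ns → T? (inS N ks ns)) (tuples N (weight ks))))

-- Both sides are values at m = 0 of iterated sums built from the indicator [m < N]: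
-- ζ_{<N} applies, for each entry k, the operator h ↦ Σ_{m<q<N} h(q)/q^k, and ζ♭_{<N}
-- applies, for each entry k, k−1 weak operators g ↦ Σ_{m≤n<N} g(n)/n followed by the
-- strict operator g ↦ Σ_{m<n<N} g(n)/(N−n).  With N = M+1, the connector
--   c(0,0) = 1,   c(q,l) = C(l−1,q−1)/C(M,q) for q, l ≥ 1,   c = 0 otherwise,
-- whose row partial sums are Σ_{l≤n} c(q,l) = C(n,q)/C(M,q) (hockey stick), intertwines
-- them: for (Cg)(m) = Σ_n c(m,n) g(n), dividing (Cg)(q) by q ≥ 1 is C of the weak
-- operator (absorption identity), and Σ_{m<q<N} (Cg)(q)/q is C of the strict operator
-- (a telescoping sum of the ratios C(n,q)/C(M,q)).  As C fixes [m < N] and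
-- (Cg)(0) = g(0), induction on the depth turns ζ_{<N}(k) into ζ♭_{<N}(k).

module Submission where

open import Defs
open import Data.Nat using (ℕ; _≤_)
open import Data.List using (List; [])
open import Data.List.Relation.Unary.All using (All)
open import Relation.Binary.PropositionalEquality using (_≡_; _≢_)

open import Algebra.Bundles using (CommutativeRing)
open import Data.Bool using (Bool; true; false; if_then_else_; _∧_)
open import Data.Bool.Properties using (T?; T-≡)
open import Data.Fin using (toℕ)
import Data.Fin.Properties as Finₚ
import Data.Integer as ℤ
import Data.Integer.Properties as ℤₚ
open import Data.List using (_∷_; map; filter; concatMap; applyUpTo; upTo; _++_; take; drop; length)
import Data.List.Properties as Listₚ
open import Data.List.Relation.Unary.All using ([]; _∷_)
open import Data.Nat as ℕ using (zero; suc; pred; _<_; z≤n; s≤s; z<s; _<ᵇ_; _≤ᵇ_; _∸_; _^_)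
open import Data.Nat.Combinatorics using (_C_; nC1≡n; k>n⇒nCk≡0; nCk+nC[k+1]≡[n+1]C[k+1])
import Data.Nat.Properties as ℕₚ
import Data.Nat.Solver as ℕ-Solver
open import Data.Rational using (ℚ; 0ℚ; 1ℚ; _+_; _*_; 1/_)
open import Data.Rational.Literals using (fromℤ)
import Data.Rational.Properties as ℚₚ
open import Data.Rational.Solver using (module +-*-Solver)
open import Data.Rational.Unnormalised using (mkℚᵘ; *≡*)
import Data.Rational.Unnormalised.Properties as ℚᵘₚ
open import Function using (_∘_; id; Equivalence)
open import Relation.Nullary using (yes; no)
open import Relation.Binary.PropositionalEquality
  using (refl; sym; trans; cong; cong₂; subst; module ≡-Reasoning)

open import Algebra.Properties.Semiring.Sum (CommutativeRing.semiring ℚₚ.+-*-commutativeRing)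
  using (sum; sum-cong-≗; sum-replicate-zero; sum-init-last; ∑-comm; *-distribˡ-sum; *-distribʳ-sum)

ι : ℕ → ℚ
ι n = fromℤ (ℤ.+ n)

ι-+ : ∀ a b → ι (a ℕ.+ b) ≡ ι a + ι b
ι-+ a b = ℚₚ.toℚᵘ-injective
  (ℚᵘₚ.≃-trans (*≡* integral) (ℚᵘₚ.≃-sym (ℚₚ.toℚᵘ-homo-+ (ι a) (ι b))))
  where
  integral : ℤ.+ (a ℕ.+ b) ℤ.* ℤ.+ 1 ≡ (ℤ.+ a ℤ.* ℤ.+ 1 ℤ.+ ℤ.+ b ℤ.* ℤ.+ 1) ℤ.* ℤ.+ 1
  integral = trans (ℤₚ.*-identityʳ _) (sym (trans (ℤₚ.*-identityʳ _)
               (cong₂ ℤ._+_ (ℤₚ.*-identityʳ (ℤ.+ a)) (ℤₚ.*-identityʳ (ℤ.+ b)))))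

ι-* : ∀ a b → ι (a ℕ.* b) ≡ ι a * ι b
ι-* a b = ℚₚ.toℚᵘ-injective
  (ℚᵘₚ.≃-trans (*≡* (cong (ℤ._* ℤ.+ 1) (ℤₚ.pos-* a b)))
               (ℚᵘₚ.≃-sym (ℚₚ.toℚᵘ-homo-* (ι a) (ι b))))

recip≡1/ι : ∀ d → recip (suc d) ≡ 1/ ι (suc d)
recip≡1/ι d = ℚₚ.toℚᵘ-injective (ℚₚ.toℚᵘ-fromℚᵘ (mkℚᵘ (ℤ.+ 1) d))

recip-inverse : ∀ d → recip (suc d) * ι (suc d) ≡ 1ℚ
recip-inverse d = trans (cong (_* ι (suc d)) (recip≡1/ι d)) (ℚₚ.*-inverseˡ (ι (suc d)))

inverse⇒recip : ∀ {d x} → x * ι (suc d) ≡ 1ℚ → x ≡ recip (suc d)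
inverse⇒recip {d} {x} x*d≡1 = begin
  x                                ≡⟨ sym (ℚₚ.*-identityʳ x) ⟩
  x * 1ℚ                           ≡⟨ cong (x *_) (sym (recip-inverse d)) ⟩
  x * (recip (suc d) * ι (suc d))  ≡⟨ solve 3 (λ x r i → x :* (r :* i) := (x :* i) :* r)
                                              refl x (recip (suc d)) (ι (suc d)) ⟩
  (x * ι (suc d)) * recip (suc d)  ≡⟨ cong (_* recip (suc d)) x*d≡1 ⟩
  1ℚ * recip (suc d)               ≡⟨ ℚₚ.*-identityˡ (recip (suc d)) ⟩
  recip (suc d)                    ∎
  where
  open ≡-Reasoning
  open +-*-Solver

recip-* : ∀ a b → recip (a ℕ.* b) ≡ recip a * recip b
recip-* zero    b       = sym (ℚₚ.*-zeroˡ (recip b))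
recip-* (suc a) zero    = trans (cong recip (ℕₚ.*-zeroʳ a)) (sym (ℚₚ.*-zeroʳ (recip (suc a))))
recip-* (suc a) (suc b) = sym (inverse⇒recip (begin
  (ra * rb) * ι (suc a ℕ.* suc b)      ≡⟨ cong ((ra * rb) *_) (ι-* (suc a) (suc b)) ⟩
  (ra * rb) * (ι (suc a) * ι (suc b))  ≡⟨ solve 4 (λ x y u v → (x :* y) :* (u :* v) := (x :* u) :* (y :* v))
                                                  refl ra rb (ι (suc a)) (ι (suc b)) ⟩
  (ra * ι (suc a)) * (rb * ι (suc b))  ≡⟨ cong₂ _*_ (recip-inverse a) (recip-inverse b) ⟩
  1ℚ * 1ℚ                              ≡⟨ ℚₚ.*-identityˡ 1ℚ ⟩
  1ℚ                                   ∎))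
  where
  open ≡-Reasoning
  open +-*-Solver
  ra = recip (suc a)
  rb = recip (suc b)

recip-^-suc : ∀ x j y → recip (x ^ suc j) * y ≡ recip x * (recip (x ^ j) * y)
recip-^-suc x j y = trans (cong (_* y) (recip-* x (x ^ j))) (ℚₚ.*-assoc (recip x) (recip (x ^ j)) y)

infixl 7 _÷_

-- a ÷ 0 = 0, since recip 0 = 0.
_÷_ : ℕ → ℕ → ℚ
a ÷ b = ι a * recip b

n÷n≡1 : ∀ n → 1 ≤ n → n ÷ n ≡ 1ℚ
n÷n≡1 (suc n) _ = trans (ℚₚ.*-comm (ι (suc n)) (recip (suc n))) (recip-inverse n)

÷-* : ∀ a b c d → (a ℕ.* b) ÷ (c ℕ.* d) ≡ (a ÷ c) * (b ÷ d)
÷-* a b c d = begin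
  ι (a ℕ.* b) * recip (c ℕ.* d)      ≡⟨ cong₂ _*_ (ι-* a b) (recip-* c d) ⟩
  (ι a * ι b) * (recip c * recip d)  ≡⟨ solve 4 (λ x y u v → (x :* y) :* (u :* v) := (x :* u) :* (y :* v))
                                                refl (ι a) (ι b) (recip c) (recip d) ⟩
  (ι a * recip c) * (ι b * recip d)  ∎
  where
  open ≡-Reasoning
  open +-*-Solver

÷-cancelˡ : ∀ s a b → (suc s ℕ.* a) ÷ (suc s ℕ.* b) ≡ a ÷ b
÷-cancelˡ s a b = begin
  (suc s ℕ.* a) ÷ (suc s ℕ.* b)  ≡⟨ ÷-* (suc s) a (suc s) b ⟩
  (suc s ÷ suc s) * (a ÷ b)      ≡⟨ cong (_* (a ÷ b)) (n÷n≡1 (suc s) (s≤s z≤n)) ⟩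
  1ℚ * (a ÷ b)                   ≡⟨ ℚₚ.*-identityˡ (a ÷ b) ⟩
  a ÷ b                          ∎
  where open ≡-Reasoning

÷-cross : ∀ a b c d → 1 ≤ b → 1 ≤ d → a ℕ.* d ≡ c ℕ.* b → a ÷ b ≡ c ÷ d
÷-cross a (suc b) c (suc d) _ _ ad≡cb = begin
  a ÷ suc b                          ≡⟨ sym (÷-cancelˡ d a (suc b)) ⟩
  (suc d ℕ.* a) ÷ (suc d ℕ.* suc b)  ≡⟨ cong₂ _÷_ (trans (ℕₚ.*-comm (suc d) a) ad≡cb)
                                                   (ℕₚ.*-comm (suc d) (suc b)) ⟩
  (c ℕ.* suc b) ÷ (suc b ℕ.* suc d)  ≡⟨ cong (_÷ (suc b ℕ.* suc d)) (ℕₚ.*-comm c (suc b)) ⟩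
  (suc b ℕ.* c) ÷ (suc b ℕ.* suc d)  ≡⟨ ÷-cancelˡ b c (suc d) ⟩
  c ÷ suc d                          ∎
  where open ≡-Reasoning

partial-fractions : ∀ v u → 1 ≤ v → recip (v ℕ.+ u) + (u ÷ (v ℕ.+ u)) * recip v ≡ recip v
partial-fractions (suc v) u _ = sym (begin
  rv                                       ≡⟨ sym (ℚₚ.*-identityʳ rv) ⟩
  rv * 1ℚ                                  ≡⟨ cong (rv *_) (sym (recip-inverse (v ℕ.+ u))) ⟩
  rv * (rw * ι (suc v ℕ.+ u))              ≡⟨ cong (λ z → rv * (rw * z)) (ι-+ (suc v) u) ⟩
  rv * (rw * (ι (suc v) + ι u))
    ≡⟨ solve 4 (λ r x s y → r :* (s :* (x :+ y)) := (r :* x) :* s :+ (y :* s) :* r) refl rv (ι (suc v)) rw (ι u) ⟩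
  (rv * ι (suc v)) * rw + (ι u * rw) * rv  ≡⟨ cong (λ z → z * rw + (ι u * rw) * rv) (recip-inverse v) ⟩
  1ℚ * rw + (ι u * rw) * rv                ≡⟨ cong (_+ (ι u * rw) * rv) (ℚₚ.*-identityˡ rw) ⟩
  rw + (ι u * rw) * rv                     ∎)
  where
  open ≡-Reasoning
  open +-*-Solver
  rv = recip (suc v)
  rw = recip (suc v ℕ.+ u)

<ᵇ-true : ∀ {x y} → x < y → (x <ᵇ y) ≡ true
<ᵇ-true x<y = Equivalence.to T-≡ (ℕₚ.<⇒<ᵇ x<y)

<ᵇ-false : ∀ {x y} → y ≤ x → (x <ᵇ y) ≡ false
<ᵇ-false {y = zero}        _         = refl
<ᵇ-false {suc x} {suc y} (s≤s y≤x) = <ᵇ-false y≤x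

<ᵇ-sound : ∀ {x y} → (x <ᵇ y) ≡ true → x < y
<ᵇ-sound {x} {y} x<ᵇy = ℕₚ.<ᵇ⇒< x y (Equivalence.from T-≡ x<ᵇy)

≤ᵇ-true : ∀ {x y} → x ≤ y → (x ≤ᵇ y) ≡ true
≤ᵇ-true x≤y = Equivalence.to T-≡ (ℕₚ.≤⇒≤ᵇ x≤y)

≤ᵇ-false : ∀ {x y} → y < x → (x ≤ᵇ y) ≡ false
≤ᵇ-false {suc x} (s≤s y≤x) = <ᵇ-false y≤x

≤ᵇ≡<ᵇsuc : ∀ x y → (x ≤ᵇ y) ≡ (x <ᵇ suc y)
≤ᵇ≡<ᵇsuc zero    y = refl
≤ᵇ≡<ᵇsuc (suc x) y = refl

if-*ˡ : ∀ (b : Bool) x y → x * (if b then y else 0ℚ) ≡ (if b then x * y else 0ℚ)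
if-*ˡ true  x y = refl
if-*ˡ false x y = ℚₚ.*-zeroʳ x

if-*ʳ : ∀ (b : Bool) x y → (if b then x else 0ℚ) * y ≡ (if b then x * y else 0ℚ)
if-*ʳ true  x y = refl
if-*ʳ false x y = ℚₚ.*-zeroˡ y

Σ< : ℕ → (ℕ → ℚ) → ℚ
Σ< n f = sum {n} (f ∘ toℕ)

Σ<-cong : ∀ n {f g : ℕ → ℚ} → (∀ i → i < n → f i ≡ g i) → Σ< n f ≡ Σ< n g
Σ<-cong n f≡g = sum-cong-≗ (λ i → f≡g (toℕ i) (Finₚ.toℕ<n i))

Σ<-zero : ∀ n {f : ℕ → ℚ} → (∀ i → i < n → f i ≡ 0ℚ) → Σ< n f ≡ 0ℚ
Σ<-zero n f≡0 = trans (Σ<-cong n f≡0) (sum-replicate-zero n)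

Σ<-*ˡ : ∀ n c (f : ℕ → ℚ) → c * Σ< n f ≡ Σ< n (λ i → c * f i)
Σ<-*ˡ n c f = *-distribˡ-sum {n} c (f ∘ toℕ)

Σ<-*ʳ : ∀ n c (f : ℕ → ℚ) → Σ< n f * c ≡ Σ< n (λ i → f i * c)
Σ<-*ʳ n c f = *-distribʳ-sum {n} c (f ∘ toℕ)

Σ<-last : ∀ n (f : ℕ → ℚ) → Σ< (suc n) f ≡ Σ< n f + f n
Σ<-last n f = trans (sum-init-last {n} (f ∘ toℕ))
  (cong₂ _+_ (sum-cong-≗ {n} (cong f ∘ Finₚ.toℕ-inject₁)) (cong f (Finₚ.toℕ-fromℕ n)))

Σ<-exchange : ∀ m n (a : ℕ → ℕ → ℚ) (g : ℕ → ℚ) →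
  Σ< m (λ i → Σ< n (λ j → a i j * g j)) ≡ Σ< n (λ j → Σ< m (λ i → a i j) * g j)
Σ<-exchange m n a g = trans (∑-comm {m} {n} (λ i j → a (toℕ i) (toℕ j) * g (toℕ j)))
  (sum-cong-≗ {n} (λ j → sym (Σ<-*ʳ m (g (toℕ j)) (λ i → a i (toℕ j)))))

Σ<-exchange-if : ∀ m n (R : ℕ → ℕ → Bool) (c h : ℕ → ℚ) →
  Σ< m (λ i → c i * Σ< n (λ j → if R i j then h j else 0ℚ)) ≡
  Σ< n (λ j → Σ< m (λ i → if R i j then c i else 0ℚ) * h j)
Σ<-exchange-if m n R c h = trans (Σ<-cong m (λ i _ → guard-inside i))
                                 (Σ<-exchange m n (λ i j → if R i j then c i else 0ℚ) h)
  where
  guard-inside : ∀ i → c i * Σ< n (λ j → if R i j then h j else 0ℚ) ≡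
                       Σ< n (λ j → (if R i j then c i else 0ℚ) * h j)
  guard-inside i = trans (Σ<-*ˡ n (c i) (λ j → if R i j then h j else 0ℚ)) (Σ<-cong n (λ j _ →
    trans (if-*ˡ (R i j) (c i) (h j)) (sym (if-*ʳ (R i j) (c i) (h j)))))

Σ<-below : ∀ N n (f : ℕ → ℚ) → n ≤ N → Σ< N (λ l → if l <ᵇ n then f l else 0ℚ) ≡ Σ< n f
Σ<-below N       zero    f _         = Σ<-zero N (λ _ _ → refl)
Σ<-below (suc N) (suc n) f (s≤s n≤N) = cong (f 0 +_) (Σ<-below N n (f ∘ suc) n≤N)

Σ<-atMost : ∀ N n (f : ℕ → ℚ) → n < N → Σ< N (λ l → if l ≤ᵇ n then f l else 0ℚ) ≡ Σ< (suc n) f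
Σ<-atMost N n f n<N = trans (Σ<-cong N (λ l _ → cong (λ b → if b then f l else 0ℚ) (≤ᵇ≡<ᵇsuc l n)))
                            (Σ<-below N (suc n) f n<N)

Σ<-above-suc : ∀ N m (f : ℕ → ℚ) →
  Σ< N (λ q → if m <ᵇ q then f q else 0ℚ) ≡
  (if suc m <ᵇ N then f (suc m) else 0ℚ) + Σ< N (λ q → if suc m <ᵇ q then f q else 0ℚ)
Σ<-above-suc zero    m       f = refl
Σ<-above-suc (suc N) zero    f = trans (ℚₚ.+-identityˡ _) (trans (split-first N (f ∘ suc))
  (cong ((if 0 <ᵇ N then f 1 else 0ℚ) +_) (sym (ℚₚ.+-identityˡ _))))
  where
  split-first : ∀ N (g : ℕ → ℚ) →
    Σ< N g ≡ (if 0 <ᵇ N then g 0 else 0ℚ) + Σ< N (λ q → if 0 <ᵇ q then g q else 0ℚ)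
  split-first zero    g = refl
  split-first (suc N) g = cong (g 0 +_) (sym (ℚₚ.+-identityˡ _))
Σ<-above-suc (suc N) (suc m) f = trans (ℚₚ.+-identityˡ _) (trans (Σ<-above-suc N m (f ∘ suc))
  (cong ((if suc m <ᵇ N then f (suc (suc m)) else 0ℚ) +_) (sym (ℚₚ.+-identityˡ _))))

Σℚ-++ : ∀ xs ys → Σℚ (xs ++ ys) ≡ Σℚ xs + Σℚ ys
Σℚ-++ []       ys = sym (ℚₚ.+-identityˡ (Σℚ ys))
Σℚ-++ (x ∷ xs) ys = trans (cong (x +_) (Σℚ-++ xs ys)) (sym (ℚₚ.+-assoc x (Σℚ xs) (Σℚ ys)))

Σℚ-concatMap : ∀ {A B : Set} (g : B → ℚ) (h : A → List B) xs →
  Σℚ (map g (concatMap h xs)) ≡ Σℚ (map (λ x → Σℚ (map g (h x))) xs)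
Σℚ-concatMap g h []       = refl
Σℚ-concatMap g h (x ∷ xs) = begin
  Σℚ (map g (h x ++ concatMap h xs))              ≡⟨ cong Σℚ (Listₚ.map-++ g (h x) (concatMap h xs)) ⟩
  Σℚ (map g (h x) ++ map g (concatMap h xs))      ≡⟨ Σℚ-++ (map g (h x)) (map g (concatMap h xs)) ⟩
  Σℚ (map g (h x)) + Σℚ (map g (concatMap h xs))  ≡⟨ cong (Σℚ (map g (h x)) +_) (Σℚ-concatMap g h xs) ⟩
  Σℚ (map g (h x)) + Σℚ (map (λ x → Σℚ (map g (h x))) xs) ∎
  where open ≡-Reasoning

Σℚ-applyUpTo : ∀ {A : Set} (g : A → ℚ) (h : ℕ → A) n → Σℚ (map g (applyUpTo h n)) ≡ Σ< n (g ∘ h)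
Σℚ-applyUpTo g h zero    = refl
Σℚ-applyUpTo g h (suc n) = cong (g (h 0) +_) (Σℚ-applyUpTo g (h ∘ suc) n)

Σℚ-filter : ∀ {A : Set} (p : A → Bool) (f : A → ℚ) xs →
  Σℚ (map f (filter (λ x → T? (p x)) xs)) ≡ Σℚ (map (λ x → if p x then f x else 0ℚ) xs)
Σℚ-filter p f []       = refl
Σℚ-filter p f (x ∷ xs) with p x
... | true  = cong (f x +_) (Σℚ-filter p f xs)
... | false = trans (Σℚ-filter p f xs) (sym (ℚₚ.+-identityˡ _))

Σℚ-guard : ∀ {A : Set} (b : Bool) c (P : A → Bool) {F h : A → ℚ} → (∀ x → F x ≡ c * h x) → ∀ xs →
  Σℚ (map (λ x → if b ∧ P x then F x else 0ℚ) xs) ≡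
  (if b then c * Σℚ (map (λ x → if P x then h x else 0ℚ) xs) else 0ℚ)
Σℚ-guard false c P F≡ch []       = refl
Σℚ-guard false c P F≡ch (x ∷ xs) = trans (ℚₚ.+-identityˡ _) (Σℚ-guard false c P F≡ch xs)
Σℚ-guard true  c P F≡ch []       = sym (ℚₚ.*-zeroʳ c)
Σℚ-guard true  c P {F} {h} F≡ch (x ∷ xs) = begin
  (if P x then F x else 0ℚ) + Σℚ (map (λ x → if P x then F x else 0ℚ) xs)
    ≡⟨ cong₂ _+_ (trans (cong (λ z → if P x then z else 0ℚ) (F≡ch x)) (sym (if-*ˡ (P x) c (h x))))
                 (Σℚ-guard true c P F≡ch xs) ⟩
  c * (if P x then h x else 0ℚ) + c * Σℚ (map (λ x → if P x then h x else 0ℚ) xs)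
    ≡⟨ sym (ℚₚ.*-distribˡ-+ c _ _) ⟩
  c * Σℚ (map (λ x → if P x then h x else 0ℚ) (x ∷ xs)) ∎
  where open ≡-Reasoning

Σtuples : ℕ → ℕ → (List ℕ → ℚ) → ℚ
Σtuples N r g = Σℚ (map g (tuples N r))

Σtuples-suc : ∀ N r (g : List ℕ → ℚ) →
  Σtuples N (suc r) g ≡ Σ< N (λ a → Σtuples N r (λ ns → g (a ∷ ns)))
Σtuples-suc N r g = begin
  Σℚ (map g (concatMap (λ a → map (a ∷_) (tuples N r)) (upTo N)))
    ≡⟨ Σℚ-concatMap g (λ a → map (a ∷_) (tuples N r)) (upTo N) ⟩
  Σℚ (map (λ a → Σℚ (map g (map (a ∷_) (tuples N r)))) (upTo N))
    ≡⟨ cong Σℚ (Listₚ.map-cong (λ a → cong Σℚ (sym (Listₚ.map-∘ (tuples N r)))) (upTo N)) ⟩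
  Σℚ (map (λ a → Σtuples N r (λ ns → g (a ∷ ns))) (upTo N))
    ≡⟨ Σℚ-applyUpTo (λ a → Σtuples N r (λ ns → g (a ∷ ns))) id N ⟩
  Σ< N (λ a → Σtuples N r (λ ns → g (a ∷ ns))) ∎
  where open ≡-Reasoning

member-here : ∀ x L → member x (x ∷ L) ≡ true
member-here x L rewrite ≤ᵇ-true (ℕₚ.≤-refl {x}) = refl

member-there : ∀ {x y} L → y < x → member x (y ∷ L) ≡ member x L
member-there L y<x rewrite ≤ᵇ-false y<x = refl

-- The positions p+1, p+1+k₁, p+1+k₁+k₂, … of J contributed by a suffix ks of the index
-- that starts after position p (Jset's helper is local, hence the detour through p ∷ ks).
Jfrom : ℕ → List ℕ → List ℕ
Jfrom p ks = drop 1 (Jset (p ∷ ks))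

member-Jfrom-≤ : ∀ {x p} ks → x ≤ p → member x (Jfrom p ks) ≡ false
member-Jfrom-≤ {x} {p} []       x≤p
  rewrite ≤ᵇ-true (ℕₚ.m≤n⇒m≤1+n x≤p) | ≤ᵇ-false (s≤s x≤p) = refl
member-Jfrom-≤ {x} {p} (k ∷ ks) x≤p
  rewrite ≤ᵇ-true (ℕₚ.m≤n⇒m≤1+n x≤p) | ≤ᵇ-false (s≤s x≤p) =
  member-Jfrom-≤ ks (ℕₚ.≤-trans x≤p (ℕₚ.m≤m+n p k))

-- chainS consults J only at the current position and later ones, so while the tuple is
-- consumed J need only agree from there on with the positions of the remaining suffix.
AgreeFrom : ℕ → List ℕ → List ℕ → Set
AgreeFrom p J L = ∀ x → p ≤ x → member x J ≡ member x L

-- Both sides as iterated sums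

module _ (N : ℕ) where

  below : ℕ → ℚ
  below m = if m <ᵇ N then 1ℚ else 0ℚ

  ζ-step : ℕ → (ℕ → ℚ) → ℕ → ℚ
  ζ-step k h m = Σ< N (λ q → if m <ᵇ q then recip (q ^ k) * h q else 0ℚ)

  ♭-strict : (ℕ → ℚ) → ℕ → ℚ
  ♭-strict g m = Σ< N (λ n → if m <ᵇ n then recip (N ∸ n) * g n else 0ℚ)

  ♭-weak : (ℕ → ℚ) → ℕ → ℚ
  ♭-weak g m = Σ< N (λ n → if m ≤ᵇ n then recip n * g n else 0ℚ)

  ♭-weak^ : ℕ → (ℕ → ℚ) → ℕ → ℚ
  ♭-weak^ zero    g = g
  ♭-weak^ (suc j) g = ♭-weak (♭-weak^ j g)

  -- ζ-from ks m and ζ♭-from ks m are ζ_{<N}(ks) and ζ♭_{<N}(ks) with the convention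
  -- n₀ = 0 replaced by n₀ = m.
  ζ-from : List ℕ → ℕ → ℚ
  ζ-from []       = below
  ζ-from (k ∷ ks) = ζ-step k (ζ-from ks)

  ζ♭-from : List ℕ → ℕ → ℚ
  ζ♭-from []       = below
  ζ♭-from (k ∷ ks) = ♭-strict (♭-weak^ (pred k) (ζ♭-from ks))

  Σ-strictChain≡ζ-from : ∀ ks m →
    Σtuples N (length ks) (λ ns → if strictChain N m ns then zetaTerm ks ns else 0ℚ) ≡ ζ-from ks m
  Σ-strictChain≡ζ-from []       m = ℚₚ.+-identityʳ (below m)
  Σ-strictChain≡ζ-from (k ∷ ks) m =
    trans (Σtuples-suc N (length ks) (λ ns → if strictChain N m ns then zetaTerm (k ∷ ks) ns else 0ℚ))
          (Σ<-cong N (λ q _ → trans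
            (Σℚ-guard (m <ᵇ q) (recip (q ^ k)) (strictChain N q) (λ _ → refl) (tuples N (length ks)))
            (cong (λ z → if m <ᵇ q then recip (q ^ k) * z else 0ℚ) (Σ-strictChain≡ζ-from ks q))))

  ζ<N≡ζ-from : ∀ ks → ζ<N N ks ≡ ζ-from ks 0
  ζ<N≡ζ-from ks = trans (Σℚ-filter (strictChain N 0) (zetaTerm ks) (tuples N (length ks)))
                        (Σ-strictChain≡ζ-from ks 0)

  Σ-chainS-cons : ∀ r J i m (G : List ℕ → ℚ) (c : ℕ → ℚ) (H : ℕ → List ℕ → ℚ) →
    (∀ n ns → G (n ∷ ns) ≡ c n * H n ns) →
    Σtuples N (suc r) (λ ns → if chainS J N i m ns then G ns else 0ℚ) ≡
    Σ< N (λ n → if (if member i J then m <ᵇ n else m ≤ᵇ n)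
                then c n * Σtuples N r (λ ns → if chainS J N (suc i) n ns then H n ns else 0ℚ)
                else 0ℚ)
  Σ-chainS-cons r J i m G c H G≡cH =
    trans (Σtuples-suc N r (λ ns → if chainS J N i m ns then G ns else 0ℚ))
          (Σ<-cong N (λ n _ → Σℚ-guard (if member i J then m <ᵇ n else m ≤ᵇ n) (c n)
                                       (chainS J N (suc i) n) (G≡cH n) (tuples N r)))

  flatBlock : ℕ → List ℕ → List ℕ → ℚ
  flatBlock j ks ns = Πℚ (map recip (take j ns)) * flatTerm N ks (drop j ns)

  mutual
    Σ-chainS≡ζ♭-from : ∀ ks → All (1 ≤_) ks → ∀ p m J → AgreeFrom (suc p) J (Jfrom p ks) →
      Σtuples N (weight ks) (λ ns → if chainS J N (suc p) m ns then flatTerm N ks ns else 0ℚ) ≡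
      ζ♭-from ks m
    Σ-chainS≡ζ♭-from [] _ p m J agree =
      trans (ℚₚ.+-identityʳ _) (cong (λ t → if (if t then m <ᵇ N else m ≤ᵇ N) then 1ℚ else 0ℚ) p+1∈J)
      where
      p+1∈J : member (suc p) J ≡ true
      p+1∈J = trans (agree (suc p) ℕₚ.≤-refl) (member-here (suc p) [])
    Σ-chainS≡ζ♭-from (suc j ∷ ks) (_ ∷ ks≥1) p m J agree =
      trans (Σ-chainS-cons (j ℕ.+ weight ks) J (suc p) m (flatTerm N (suc j ∷ ks)) (λ n → recip (N ∸ n))
                           (λ _ → flatBlock j ks) (λ n ns → ℚₚ.*-assoc (recip (N ∸ n)) _ _))
            (Σ<-cong N (λ n _ →
              cong₂ (λ t z → if (if t then m <ᵇ n else m ≤ᵇ n) then recip (N ∸ n) * z else 0ℚ)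
                    p+1∈J (Σ-block≡♭-weak^ j ks ks≥1 (suc p) n J agree′)))
      where
      p+1∈J : member (suc p) J ≡ true
      p+1∈J = trans (agree (suc p) ℕₚ.≤-refl) (member-here (suc p) (Jfrom (p ℕ.+ suc j) ks))
      agree′ : AgreeFrom (suc (suc p)) J (Jfrom (suc p ℕ.+ j) ks)
      agree′ x p+2≤x = trans (agree x (ℕₚ.<⇒≤ p+2≤x))
        (trans (member-there (Jfrom (p ℕ.+ suc j) ks) p+2≤x)
               (cong (λ q → member x (Jfrom q ks)) (ℕₚ.+-suc p j)))

    Σ-block≡♭-weak^ : ∀ j ks → All (1 ≤_) ks → ∀ p m J → AgreeFrom (suc p) J (Jfrom (p ℕ.+ j) ks) →
      Σtuples N (j ℕ.+ weight ks) (λ ns → if chainS J N (suc p) m ns then flatBlock j ks ns else 0ℚ) ≡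
      ♭-weak^ j (ζ♭-from ks) m
    Σ-block≡♭-weak^ zero ks ks≥1 p m J agree =
      trans (cong Σℚ (Listₚ.map-cong (λ ns → cong (λ z → if chainS J N (suc p) m ns then z else 0ℚ)
                                                   (ℚₚ.*-identityˡ (flatTerm N ks ns)))
                                     (tuples N (weight ks))))
            (Σ-chainS≡ζ♭-from ks ks≥1 p m J (λ x p+1≤x →
              trans (agree x p+1≤x) (cong (λ q → member x (Jfrom q ks)) (ℕₚ.+-identityʳ p))))
    Σ-block≡♭-weak^ (suc j) ks ks≥1 p m J agree =
      trans (Σ-chainS-cons (j ℕ.+ weight ks) J (suc p) m (flatBlock (suc j) ks) recip
                           (λ _ → flatBlock j ks) (λ n ns → ℚₚ.*-assoc (recip n) _ _))
            (Σ<-cong N (λ n _ →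
              cong₂ (λ t z → if (if t then m <ᵇ n else m ≤ᵇ n) then recip n * z else 0ℚ)
                    p+1∉J (Σ-block≡♭-weak^ j ks ks≥1 (suc p) n J agree′)))
      where
      p+1∉J : member (suc p) J ≡ false
      p+1∉J = trans (agree (suc p) ℕₚ.≤-refl)
        (member-Jfrom-≤ ks (subst (suc p ≤_) (sym (ℕₚ.+-suc p j)) (s≤s (ℕₚ.m≤m+n p j))))
      agree′ : AgreeFrom (suc (suc p)) J (Jfrom (suc p ℕ.+ j) ks)
      agree′ x p+2≤x = trans (agree x (ℕₚ.<⇒≤ p+2≤x))
                             (cong (λ q → member x (Jfrom q ks)) (ℕₚ.+-suc p j))

  ζ♭<N≡ζ♭-from : ∀ ks → All (1 ≤_) ks → ζ♭<N N ks ≡ ζ♭-from ks 0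
  ζ♭<N≡ζ♭-from ks ks≥1 = trans (Σℚ-filter (inS N ks) (flatTerm N ks) (tuples N (weight ks)))
                               (Σ-chainS≡ζ♭-from ks ks≥1 0 0 (Jset ks) (λ _ _ → refl))

-- Binomial coefficients

pascal : ∀ n k → suc n C suc k ≡ n C k ℕ.+ n C suc k
pascal n k = sym (nCk+nC[k+1]≡[n+1]C[k+1] n k)

C-pos : ∀ {n k} → k ≤ n → 1 ≤ n C k
C-pos {n}     {zero}  _         = s≤s z≤n
C-pos {suc n} {suc k} (s≤s k≤n) =
  subst (1 ≤_) (sym (pascal n k)) (ℕₚ.≤-trans (C-pos k≤n) (ℕₚ.m≤m+n (n C k) (n C suc k)))

C-absorb : ∀ n k → suc k ℕ.* (suc n C suc k) ≡ suc n ℕ.* (n C k)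
C-absorb zero    zero    = refl
C-absorb zero    (suc k) = ℕₚ.*-zeroʳ (suc (suc k))
C-absorb (suc n) zero    = trans (ℕₚ.*-identityˡ _) (trans (nC1≡n (suc (suc n))) (sym (ℕₚ.*-identityʳ _)))
C-absorb (suc n) (suc k) = begin
  suc (suc k) ℕ.* (suc (suc n) C suc (suc k))
    ≡⟨ cong (suc (suc k) ℕ.*_) (pascal (suc n) (suc k)) ⟩
  suc (suc k) ℕ.* (suc n C suc k ℕ.+ suc n C suc (suc k))
    ≡⟨ solve 3 (λ k x y → (con 2 :+ k) :* (x :+ y) := ((con 1 :+ k) :* x :+ x) :+ (con 2 :+ k) :* y)
               refl k (suc n C suc k) (suc n C suc (suc k)) ⟩
  (suc k ℕ.* (suc n C suc k) ℕ.+ suc n C suc k) ℕ.+ suc (suc k) ℕ.* (suc n C suc (suc k))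
    ≡⟨ cong₂ (λ x y → (x ℕ.+ suc n C suc k) ℕ.+ y) (C-absorb n k) (C-absorb n (suc k)) ⟩
  (suc n ℕ.* (n C k) ℕ.+ suc n C suc k) ℕ.+ suc n ℕ.* (n C suc k)
    ≡⟨ cong (λ x → (suc n ℕ.* (n C k) ℕ.+ x) ℕ.+ suc n ℕ.* (n C suc k)) (pascal n k) ⟩
  (suc n ℕ.* (n C k) ℕ.+ (n C k ℕ.+ n C suc k)) ℕ.+ suc n ℕ.* (n C suc k)
    ≡⟨ solve 3 (λ n a b → ((con 1 :+ n) :* a :+ (a :+ b)) :+ (con 1 :+ n) :* b := (con 2 :+ n) :* (a :+ b))
               refl n (n C k) (n C suc k) ⟩
  suc (suc n) ℕ.* (n C k ℕ.+ n C suc k)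
    ≡⟨ cong (suc (suc n) ℕ.*_) (sym (pascal n k)) ⟩
  suc (suc n) ℕ.* (suc n C suc k) ∎
  where
  open ≡-Reasoning
  open ℕ-Solver.+-*-Solver

C-suc : ∀ {n m} → m ≤ n → suc m ℕ.* (n C suc m) ≡ (n ∸ m) ℕ.* (n C m)
C-suc {n} {m} m≤n = ℕₚ.+-cancelˡ-≡ (suc m ℕ.* (n C m)) _ _ (begin
  suc m ℕ.* (n C m) ℕ.+ suc m ℕ.* (n C suc m)  ≡⟨ sym (ℕₚ.*-distribˡ-+ (suc m) (n C m) (n C suc m)) ⟩
  suc m ℕ.* (n C m ℕ.+ n C suc m)              ≡⟨ cong (suc m ℕ.*_) (sym (pascal n m)) ⟩
  suc m ℕ.* (suc n C suc m)                    ≡⟨ C-absorb n m ⟩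
  suc n ℕ.* (n C m)                            ≡⟨ cong (λ x → suc x ℕ.* (n C m))
                                                       (sym (ℕₚ.m+[n∸m]≡n m≤n)) ⟩
  (suc m ℕ.+ (n ∸ m)) ℕ.* (n C m)              ≡⟨ ℕₚ.*-distribʳ-+ (n C m) (suc m) (n ∸ m) ⟩
  suc m ℕ.* (n C m) ℕ.+ (n ∸ m) ℕ.* (n C m)    ∎)
  where open ≡-Reasoning

hockey-stick : ∀ q n → Σ< n (λ i → ι (i C q)) ≡ ι (n C suc q)
hockey-stick q zero    = refl
hockey-stick q (suc n) = begin
  Σ< (suc n) (λ i → ι (i C q))        ≡⟨ Σ<-last n (λ i → ι (i C q)) ⟩
  Σ< n (λ i → ι (i C q)) + ι (n C q)  ≡⟨ cong (_+ ι (n C q)) (hockey-stick q n) ⟩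
  ι (n C suc q) + ι (n C q)           ≡⟨ sym (ι-+ (n C suc q) (n C q)) ⟩
  ι (n C suc q ℕ.+ n C q)             ≡⟨ cong ι (trans (ℕₚ.+-comm (n C suc q) (n C q)) (sym (pascal n q))) ⟩
  ι (suc n C suc q)                   ∎
  where open ≡-Reasoning

∸-split : ∀ {M n m} → m ≤ n → n ≤ M → M ∸ m ≡ (M ∸ n) ℕ.+ (n ∸ m)
∸-split {M} {n} {m} m≤n n≤M =
  trans (cong (_∸ m) (sym (ℕₚ.m∸n+n≡m n≤M))) (ℕₚ.+-∸-assoc (M ∸ n) m≤n)

-- Rearranged: (C(n,m)/C(M,m+1))/(m+1) = (T m − T (m+1))/(M−n) for T m = C(n,m)/C(M,m),
-- so the tail sums in conn-strict telescope.
ratio-step : ∀ {M n m} → m ≤ n → n < M →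
  recip (suc m) * ((n C m) ÷ (M C suc m)) + ((n C suc m) ÷ (M C suc m)) * recip (M ∸ n) ≡
  ((n C m) ÷ (M C m)) * recip (M ∸ n)
ratio-step {M} {n} {m} m≤n n<M = begin
  recip (suc m) * (ι a * recip B) + (b ÷ B) * recip (M ∸ n)
    ≡⟨ cong₂ (λ x y → x + y * recip (M ∸ n)) first second ⟩
  T * recip (M ∸ m) + (T * ((n ∸ m) ÷ (M ∸ m))) * recip (M ∸ n)
    ≡⟨ solve 4 (λ t x y z → t :* x :+ (t :* y) :* z := t :* (x :+ y :* z))
               refl T (recip (M ∸ m)) ((n ∸ m) ÷ (M ∸ m)) (recip (M ∸ n)) ⟩
  T * (recip (M ∸ m) + ((n ∸ m) ÷ (M ∸ m)) * recip (M ∸ n))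
    ≡⟨ cong (λ w → T * (recip w + ((n ∸ m) ÷ w) * recip (M ∸ n))) (∸-split m≤n (ℕₚ.<⇒≤ n<M)) ⟩
  T * (recip ((M ∸ n) ℕ.+ (n ∸ m)) + ((n ∸ m) ÷ ((M ∸ n) ℕ.+ (n ∸ m))) * recip (M ∸ n))
    ≡⟨ cong (T *_) (partial-fractions (M ∸ n) (n ∸ m) (ℕₚ.m<n⇒0<n∸m n<M)) ⟩
  T * recip (M ∸ n) ∎
  where
  open ≡-Reasoning
  open +-*-Solver
  a = n C m
  b = n C suc m
  A = M C m
  B = M C suc m
  T = a ÷ A
  m≤M = ℕₚ.≤-trans m≤n (ℕₚ.<⇒≤ n<M)
  first : recip (suc m) * (ι a * recip B) ≡ T * recip (M ∸ m)
  first = begin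
    recip (suc m) * (ι a * recip B)  ≡⟨ solve 3 (λ r x y → r :* (x :* y) := x :* (r :* y))
                                                refl (recip (suc m)) (ι a) (recip B) ⟩
    ι a * (recip (suc m) * recip B)  ≡⟨ cong (ι a *_) (sym (recip-* (suc m) B)) ⟩
    ι a * recip (suc m ℕ.* B)        ≡⟨ cong (λ x → ι a * recip x) (C-suc m≤M) ⟩
    ι a * recip ((M ∸ m) ℕ.* A)      ≡⟨ cong (ι a *_) (recip-* (M ∸ m) A) ⟩
    ι a * (recip (M ∸ m) * recip A)  ≡⟨ solve 3 (λ x r y → x :* (r :* y) := (x :* y) :* r)
                                                refl (ι a) (recip (M ∸ m)) (recip A) ⟩
    T * recip (M ∸ m)                ∎
  second : b ÷ B ≡ T * ((n ∸ m) ÷ (M ∸ m))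
  second = begin
    b ÷ B                              ≡⟨ sym (÷-cancelˡ m b B) ⟩
    (suc m ℕ.* b) ÷ (suc m ℕ.* B)      ≡⟨ cong₂ _÷_ (C-suc m≤n) (C-suc m≤M) ⟩
    ((n ∸ m) ℕ.* a) ÷ ((M ∸ m) ℕ.* A)  ≡⟨ ÷-* (n ∸ m) a (M ∸ m) A ⟩
    ((n ∸ m) ÷ (M ∸ m)) * T            ≡⟨ ℚₚ.*-comm ((n ∸ m) ÷ (M ∸ m)) T ⟩
    T * ((n ∸ m) ÷ (M ∸ m))            ∎

downward-induction : ∀ {ℓ} (P : ℕ → Set ℓ) n →
  (∀ m → n < m → P m) → (∀ m → m ≤ n → P (suc m) → P m) → ∀ m → P m
downward-induction P n above step m = go (suc n) m (s≤s (ℕₚ.m≤m+n n m))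
  where
  go : ∀ t m → n < t ℕ.+ m → P m
  go zero    m n<m = above m n<m
  go (suc t) m n<t+1+m with m ℕₚ.≤? n
  ... | yes m≤n = step m m≤n (go t (suc m) (subst (n <_) (sym (ℕₚ.+-suc t m)) n<t+1+m))
  ... | no  m≰n = above m (ℕₚ.≰⇒> m≰n)

-- The connector

module _ (M : ℕ) where

  private
    N : ℕ
    N = suc M

  conn : ℕ → ℕ → ℚ
  conn zero    zero    = 1ℚ
  conn zero    (suc l) = 0ℚ
  conn (suc q) zero    = 0ℚ
  conn (suc q) (suc l) = (l C q) ÷ (M C suc q)

  connect : (ℕ → ℚ) → ℕ → ℚ
  connect g m = Σ< N (λ n → conn m n * g n)

  conn-partial : ∀ q n → Σ< (suc n) (conn q) ≡ (n C q) ÷ (M C q)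
  conn-partial zero    n = cong (1ℚ +_) (Σ<-zero n (λ _ _ → refl))
  conn-partial (suc q) n = begin
    0ℚ + Σ< n (λ l → ι (l C q) * recip (M C suc q))  ≡⟨ ℚₚ.+-identityˡ _ ⟩
    Σ< n (λ l → ι (l C q) * recip (M C suc q))       ≡⟨ sym (Σ<-*ʳ n (recip (M C suc q)) (λ l → ι (l C q))) ⟩
    Σ< n (λ l → ι (l C q)) * recip (M C suc q)       ≡⟨ cong (_* recip (M C suc q)) (hockey-stick q n) ⟩
    (n C suc q) ÷ (M C suc q)                        ∎
    where open ≡-Reasoning

  conn-weak : ∀ q n → recip (suc q) * conn (suc q) n ≡ Σ< (suc n) (conn (suc q)) * recip n
  conn-weak q zero    = trans (ℚₚ.*-zeroʳ (recip (suc q))) (sym (ℚₚ.*-zeroʳ (Σ< 1 (conn (suc q)))))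
  conn-weak q (suc n) = begin
    recip (suc q) * (ι (n C q) * recip B)  ≡⟨ solve 3 (λ r x y → r :* (x :* y) := (x :* r) :* y)
                                                      refl (recip (suc q)) (ι (n C q)) (recip B) ⟩
    ((n C q) ÷ suc q) * recip B            ≡⟨ cong (_* recip B) (÷-cross (n C q) (suc q) (suc n C suc q) (suc n)
                                                                         (s≤s z≤n) (s≤s z≤n) absorb) ⟩
    ((suc n C suc q) ÷ suc n) * recip B    ≡⟨ solve 3 (λ x r y → (x :* r) :* y := (x :* y) :* r)
                                                      refl (ι (suc n C suc q)) (recip (suc n)) (recip B) ⟩
    ((suc n C suc q) ÷ B) * recip (suc n)  ≡⟨ cong (_* recip (suc n)) (sym (conn-partial (suc q) (suc n))) ⟩
    Σ< (suc (suc n)) (conn (suc q)) * recip (suc n) ∎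
    where
    open ≡-Reasoning
    open +-*-Solver
    B = M C suc q
    absorb : (n C q) ℕ.* suc n ≡ (suc n C suc q) ℕ.* suc q
    absorb = trans (ℕₚ.*-comm (n C q) (suc n))
                   (trans (sym (C-absorb n q)) (ℕₚ.*-comm (suc q) (suc n C suc q)))

  connect-weak : ∀ g q → recip (suc q) * connect g (suc q) ≡ connect (♭-weak N g) (suc q)
  connect-weak g q = begin
    recip (suc q) * Σ< N (λ n → conn (suc q) n * g n)
      ≡⟨ Σ<-*ˡ N (recip (suc q)) (λ n → conn (suc q) n * g n) ⟩
    Σ< N (λ n → recip (suc q) * (conn (suc q) n * g n))
      ≡⟨ Σ<-cong N pointwise ⟩
    Σ< N (λ n → Σ< N (λ l → if l ≤ᵇ n then conn (suc q) l else 0ℚ) * (recip n * g n))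
      ≡⟨ sym (Σ<-exchange-if N N _≤ᵇ_ (conn (suc q)) (λ n → recip n * g n)) ⟩
    connect (♭-weak N g) (suc q) ∎
    where
    open ≡-Reasoning
    pointwise : ∀ n → n < N → recip (suc q) * (conn (suc q) n * g n) ≡
                              Σ< N (λ l → if l ≤ᵇ n then conn (suc q) l else 0ℚ) * (recip n * g n)
    pointwise n n<N = begin
      recip (suc q) * (conn (suc q) n * g n)       ≡⟨ sym (ℚₚ.*-assoc (recip (suc q)) (conn (suc q) n) (g n)) ⟩
      (recip (suc q) * conn (suc q) n) * g n       ≡⟨ cong (_* g n) (conn-weak q n) ⟩
      (Σ< (suc n) (conn (suc q)) * recip n) * g n  ≡⟨ ℚₚ.*-assoc (Σ< (suc n) (conn (suc q))) (recip n) (g n) ⟩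
      Σ< (suc n) (conn (suc q)) * (recip n * g n)  ≡⟨ cong (_* (recip n * g n))
                                                           (sym (Σ<-atMost N n (conn (suc q)) n<N)) ⟩
      Σ< N (λ l → if l ≤ᵇ n then conn (suc q) l else 0ℚ) * (recip n * g n) ∎

  connect-weak^ : ∀ j g q → recip (suc q ^ j) * connect g (suc q) ≡ connect (♭-weak^ N j g) (suc q)
  connect-weak^ zero    g q = ℚₚ.*-identityˡ (connect g (suc q))
  connect-weak^ (suc j) g q = begin
    recip (suc q ^ suc j) * connect g (suc q)                ≡⟨ recip-^-suc (suc q) j (connect g (suc q)) ⟩
    recip (suc q) * (recip (suc q ^ j) * connect g (suc q))  ≡⟨ cong (recip (suc q) *_) (connect-weak^ j g q) ⟩
    recip (suc q) * connect (♭-weak^ N j g) (suc q)          ≡⟨ connect-weak (♭-weak^ N j g) q ⟩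
    connect (♭-weak^ N (suc j) g) (suc q)                    ∎
    where open ≡-Reasoning

  conn-strict : ∀ m n → n < N →
    Σ< N (λ q → if m <ᵇ q then recip q * conn q n else 0ℚ) ≡ Σ< n (conn m) * recip (N ∸ n)
  conn-strict m zero    _         = trans (Σ<-zero N vanish) (sym (ℚₚ.*-zeroˡ (recip N)))
    where
    vanish : ∀ q → q < N → (if m <ᵇ q then recip q * conn q 0 else 0ℚ) ≡ 0ℚ
    vanish zero    _ = refl
    vanish (suc q) _ with m <ᵇ suc q
    ... | false = refl
    ... | true  = ℚₚ.*-zeroʳ (recip (suc q))
  conn-strict m (suc n) (s≤s n<M) =
    trans (downward-induction (λ m → tail m ≡ closed m) n vanish step m)
          (cong (_* recip (M ∸ n)) (sym (conn-partial m n)))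
    where
    tail closed : ℕ → ℚ
    tail   m = Σ< N (λ q → if m <ᵇ q then recip q * conn q (suc n) else 0ℚ)
    closed m = ((n C m) ÷ (M C m)) * recip (M ∸ n)

    vanish : ∀ m → n < m → tail m ≡ closed m
    vanish m n<m = trans (Σ<-zero N term≡0) (sym (begin
      ι (n C m) * recip (M C m) * recip (M ∸ n)  ≡⟨ cong (λ x → ι x * recip (M C m) * recip (M ∸ n))
                                                         (k>n⇒nCk≡0 n<m) ⟩
      0ℚ * recip (M C m) * recip (M ∸ n)         ≡⟨ cong (_* recip (M ∸ n)) (ℚₚ.*-zeroˡ (recip (M C m))) ⟩
      0ℚ * recip (M ∸ n)                         ≡⟨ ℚₚ.*-zeroˡ (recip (M ∸ n)) ⟩
      0ℚ                                         ∎))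
      where
      open ≡-Reasoning
      term≡0 : ∀ q → q < N → (if m <ᵇ q then recip q * conn q (suc n) else 0ℚ) ≡ 0ℚ
      term≡0 zero    _ = refl
      term≡0 (suc q) _ with m <ᵇ suc q in m<ᵇq
      ... | false = refl
      ... | true  = begin
        recip (suc q) * (ι (n C q) * recip (M C suc q))
          ≡⟨ cong (λ x → recip (suc q) * (ι x * recip (M C suc q)))
                  (k>n⇒nCk≡0 (ℕₚ.<-≤-trans n<m (ℕₚ.≤-pred (<ᵇ-sound m<ᵇq)))) ⟩
        recip (suc q) * (0ℚ * recip (M C suc q))
          ≡⟨ cong (recip (suc q) *_) (ℚₚ.*-zeroˡ (recip (M C suc q))) ⟩
        recip (suc q) * 0ℚ
          ≡⟨ ℚₚ.*-zeroʳ (recip (suc q)) ⟩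
        0ℚ ∎

    step : ∀ m → m ≤ n → tail (suc m) ≡ closed (suc m) → tail m ≡ closed m
    step m m≤n tail≡closed = begin
      tail m
        ≡⟨ Σ<-above-suc N m (λ q → recip q * conn q (suc n)) ⟩
      (if suc m <ᵇ N then recip (suc m) * conn (suc m) (suc n) else 0ℚ) + tail (suc m)
        ≡⟨ cong₂ (λ b x → (if b then recip (suc m) * conn (suc m) (suc n) else 0ℚ) + x)
                 (<ᵇ-true (s≤s (ℕₚ.≤-<-trans m≤n n<M))) tail≡closed ⟩
      recip (suc m) * ((n C m) ÷ (M C suc m)) + closed (suc m)
        ≡⟨ ratio-step m≤n n<M ⟩
      closed m ∎
      where open ≡-Reasoning

  connect-strict : ∀ g m →
    Σ< N (λ q → if m <ᵇ q then recip q * connect g q else 0ℚ) ≡ connect (♭-strict N g) m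
  connect-strict g m = begin
    Σ< N (λ q → if m <ᵇ q then recip q * Σ< N (λ n → conn q n * g n) else 0ℚ)
      ≡⟨ Σ<-cong N (λ q _ → guard-inside q) ⟩
    Σ< N (λ q → Σ< N (λ n → c q n * g n))
      ≡⟨ Σ<-exchange N N c g ⟩
    Σ< N (λ n → Σ< N (λ q → c q n) * g n)
      ≡⟨ Σ<-cong N pointwise ⟩
    Σ< N (λ n → Σ< N (λ l → if l <ᵇ n then conn m l else 0ℚ) * (recip (N ∸ n) * g n))
      ≡⟨ sym (Σ<-exchange-if N N _<ᵇ_ (conn m) (λ n → recip (N ∸ n) * g n)) ⟩
    connect (♭-strict N g) m ∎
    where
    open ≡-Reasoning
    c : ℕ → ℕ → ℚ
    c q n = if m <ᵇ q then recip q * conn q n else 0ℚ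

    guard-inside : ∀ q → (if m <ᵇ q then recip q * Σ< N (λ n → conn q n * g n) else 0ℚ) ≡
                         Σ< N (λ n → c q n * g n)
    guard-inside q with m <ᵇ q
    ... | false = sym (Σ<-zero N (λ n _ → ℚₚ.*-zeroˡ (g n)))
    ... | true  = trans (Σ<-*ˡ N (recip q) (λ n → conn q n * g n))
                        (Σ<-cong N (λ n _ → sym (ℚₚ.*-assoc (recip q) (conn q n) (g n))))

    pointwise : ∀ n → n < N → Σ< N (λ q → c q n) * g n ≡
                              Σ< N (λ l → if l <ᵇ n then conn m l else 0ℚ) * (recip (N ∸ n) * g n)
    pointwise n n<N = begin
      Σ< N (λ q → c q n) * g n                   ≡⟨ cong (_* g n) (conn-strict m n n<N) ⟩
      (Σ< n (conn m) * recip (N ∸ n)) * g n      ≡⟨ ℚₚ.*-assoc (Σ< n (conn m)) (recip (N ∸ n)) (g n) ⟩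
      Σ< n (conn m) * (recip (N ∸ n) * g n)      ≡⟨ cong (_* (recip (N ∸ n) * g n))
                                                         (sym (Σ<-below N n (conn m) (ℕₚ.<⇒≤ n<N))) ⟩
      Σ< N (λ l → if l <ᵇ n then conn m l else 0ℚ) * (recip (N ∸ n) * g n) ∎

  connect-ζ-step : ∀ j g m → ζ-step N (suc j) (connect g) m ≡ connect (♭-strict N (♭-weak^ N j g)) m
  connect-ζ-step j g m = trans (Σ<-cong N (λ q _ → peel-power q)) (connect-strict (♭-weak^ N j g) m)
    where
    peel-power : ∀ q → (if m <ᵇ q then recip (q ^ suc j) * connect g q else 0ℚ) ≡
                       (if m <ᵇ q then recip q * connect (♭-weak^ N j g) q else 0ℚ)
    peel-power zero    = refl
    peel-power (suc q) = cong (λ x → if m <ᵇ suc q then x else 0ℚ)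
      (trans (recip-^-suc (suc q) j (connect g (suc q))) (cong (recip (suc q) *_) (connect-weak^ j g q)))

  connect-below : ∀ m → m ≤ M → connect (below N) m ≡ 1ℚ
  connect-below m m≤M = begin
    Σ< N (λ n → conn m n * below N n)
      ≡⟨ Σ<-cong N (λ n n<N → trans (cong (λ b → conn m n * (if b then 1ℚ else 0ℚ)) (<ᵇ-true n<N))
                                    (ℚₚ.*-identityʳ (conn m n))) ⟩
    Σ< N (conn m)                      ≡⟨ conn-partial m M ⟩
    (M C m) ÷ (M C m)                  ≡⟨ n÷n≡1 (M C m) (C-pos m≤M) ⟩
    1ℚ                                 ∎
    where open ≡-Reasoning

  connect-at-0 : ∀ g → connect g 0 ≡ g 0
  connect-at-0 g = begin
    1ℚ * g 0 + Σ< M (λ n → 0ℚ * g (suc n))  ≡⟨ cong₂ _+_ (ℚₚ.*-identityˡ (g 0))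
                                                         (Σ<-zero M (λ n _ → ℚₚ.*-zeroˡ (g (suc n)))) ⟩
    g 0 + 0ℚ                                ≡⟨ ℚₚ.+-identityʳ (g 0) ⟩
    g 0                                     ∎
    where open ≡-Reasoning

  ζ-from≡connect : ∀ ks → All (1 ≤_) ks → ∀ m → m < N → ζ-from N ks m ≡ connect (ζ♭-from N ks) m
  ζ-from≡connect []           _          m m<N =
    trans (cong (λ b → if b then 1ℚ else 0ℚ) (<ᵇ-true m<N)) (sym (connect-below m (ℕₚ.≤-pred m<N)))
  ζ-from≡connect (suc j ∷ ks) (_ ∷ ks≥1) m _   =
    trans (Σ<-cong N (λ q q<N → cong (λ x → if m <ᵇ q then recip (q ^ suc j) * x else 0ℚ)
                                     (ζ-from≡connect ks ks≥1 q q<N)))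
          (connect-ζ-step j (ζ♭-from N ks) m)

theorem1p3 : (N : ℕ) → 1 ≤ N → (ks : List ℕ) → ks ≢ [] → All (1 ≤_) ks →
    ζ<N N ks ≡ ζ♭<N N ks
theorem1p3 (suc M) _ ks _ ks≥1 = begin
  ζ<N (suc M) ks                    ≡⟨ ζ<N≡ζ-from (suc M) ks ⟩
  ζ-from (suc M) ks 0               ≡⟨ ζ-from≡connect M ks ks≥1 0 z<s ⟩
  connect M (ζ♭-from (suc M) ks) 0  ≡⟨ connect-at-0 M (ζ♭-from (suc M) ks) ⟩
  ζ♭-from (suc M) ks 0              ≡⟨ sym (ζ♭<N≡ζ♭-from (suc M) ks ks≥1) ⟩
  ζ♭<N (suc M) ks                   ∎
  where open ≡-Reasoning
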